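{- Let $P$ be a Fano polygon and let $v_1,\dots,v_k$ be lattice points on the boundary of $P$, listed in anticlockwise order and including all vertices of $P$, such that $\det(v_i\ v_{i+1})=r$ for all $i$ (indices cyclic), so that $v_1,\dots,v_k$ is an $r$-modular sequence with all $\epsilon_i=1$. Then $a_i\ge-2$ for all $i$. Furthermore, if $a_i=-2$ then $v_{i-1},v_i,v_{i+1}$ lie on a common edge of $P$, i.e. the cones $\mathrm{Cone}(v_{i-1},v_i)$ and $\mathrm{Cone}(v_i,v_{i+1})$ lie over the same edge of $P$ and $v_i$ need not be listed as a vertex.
   Context: A Fano polygon is a convex lattice polygon in $\mathbb{R}^2$ containing the origin in its interior whose vertices are primitive lattice points. A sequence $v_1,\dots,v_k$ of primitive vectors in $\mathbb{Z}^2$ is $r$-modular if $\det(v_i\ v_{i+1})=\pm r$ for all $i$ (indices cyclic: $v_0=v_k$, $v_{k+1}=v_1$); set $\epsilon_i=\frac1r\det(v_i\ v_{i+1})$. The integer $a_i$ is defined by $\epsilon_{i-1}v_{i-1}+\epsilon_iv_{i+1}+a_iv_i=0$. -}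

module Defs where

open import Data.Nat as ℕ using (ℕ; suc)
open import Data.Nat.GCD using (gcd)
open import Data.Nat.DivMod using (_mod_)
open import Data.Fin using (Fin; toℕ)
open import Data.Integer using (ℤ; +_; _+_; _-_; _*_; -_; ∣_∣; _≤_; _<_)
open import Data.Product using (_×_; _,_; ∃)
open import Relation.Binary.PropositionalEquality using (_≡_; _≢_)
open import Relation.Nullary using (¬_)

Pt : Set
Pt = ℤ × ℤ

origin : Pt
origin = (+ 0 , + 0)

_⊖_ : Pt → Pt → Pt
(a , b) ⊖ (c , d) = (a - c , b - d)

_⊕_ : Pt → Pt → Pt
(a , b) ⊕ (c , d) = (a + c , b + d)

_·_ : ℤ → Pt → Pt
t · (a , b) = (t * a , t * b)

det : Pt → Pt → ℤ
det (a , b) (c , d) = a * d - b * c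

dot : Pt → Pt → ℤ
dot (a , b) (c , d) = a * c + b * d

Primitive : Pt → Set
Primitive (a , b) = gcd ∣ a ∣ ∣ b ∣ ≡ 1

nxt : ∀ {n} → Fin (suc n) → Fin (suc n)
nxt {n} i = suc (toℕ i) mod suc n

prv : ∀ {n} → Fin (suc n) → Fin (suc n)
prv {n} i = (toℕ i ℕ.+ n) mod suc n

-- x lies on the closed segment [a , b]  (a ≢ b in all uses)
OnSegment : Pt → Pt → Pt → Set
OnSegment a b x =
  (det (b ⊖ a) (x ⊖ a) ≡ + 0)
  × (+ 0 ≤ dot (x ⊖ a) (b ⊖ a))
  × (dot (x ⊖ a) (b ⊖ a) ≤ dot (b ⊖ a) (b ⊖ a))

-- A convex lattice polygon given by its vertices w₀,…,w_{m-1} listed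
-- anticlockwise (m ≥ 3): every other vertex lies strictly to the left of
-- the directed line through each edge w_j → w_{j+1}.
record Polygon : Set where
  field
    m      : ℕ
    w      : Fin (suc (suc (suc m))) → Pt
    convex : ∀ j l → l ≢ j → l ≢ nxt j →
             + 0 < det (w (nxt j) ⊖ w j) (w l ⊖ w j)

open Polygon public

-- Fano polygon: origin in the interior (strictly left of every edge line)
-- and all vertices primitive.
record IsFano (P : Polygon) : Set where
  field
    originInterior : ∀ j → + 0 < det (w P (nxt j) ⊖ w P j) (origin ⊖ w P j)
    primitiveVerts : ∀ j → Primitive (w P j)

OnEdge : (P : Polygon) → Fin (suc (suc (suc (m P)))) → Pt → Set
OnEdge P j x = OnSegment (w P j) (w P (nxt j)) x

OnBoundary : Polygon → Pt → Set
OnBoundary P x = ∃ λ j → OnEdge P j x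

-- v₀,…,v_k (k = suc n points) is listed in anticlockwise order around the
-- origin, each point exactly once, going around exactly once: the points are
-- distinct, each consecutive pair turns anticlockwise by an angle in (0,π),
-- and no other listed point lies in the open angular sector between v_i and
-- v_{i+1}.
Anticlockwise : ∀ {n} → (Fin (suc n) → Pt) → Set
Anticlockwise {n} v =
  (∀ i j → v i ≡ v j → i ≡ j)
  × (∀ i → + 0 < det (v i) (v (nxt i)))
  × (∀ i j → ¬ ((+ 0 < det (v i) (v j)) × (+ 0 < det (v j) (v (nxt i)))))

-- Let [A, B] be an edge of P through v_i and h x = det (B − A) (x − A).  The affine
-- function h is nonnegative at every vertex, hence on the boundary; h (v_i) = 0, and
-- h 0 > 0 because the origin is interior.  Applying h to q (v_{i−1} + v_{i+1}) + p v_i = 0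
-- gives q (h v_{i−1} + h v_{i+1}) = (2q + p) h 0, so 2q + p ≥ 0; in the case of equality
-- v_{i−1} and v_{i+1} are boundary points on the line AB, hence on the edge [A, B].
-- (With ε_i = 1 the relation holds with q = 1 and p = a_i.)
module Submission where

open import Defs
open import Data.Nat using (ℕ; suc)
open import Data.Fin using (Fin)
open import Data.Integer using (ℤ; +_; -_; _*_; _≤_; _<_)
open import Data.Product using (_×_; ∃)
open import Relation.Binary.PropositionalEquality using (_≡_)

open import Data.Nat using (z≤n; s≤s)
open import Data.Fin.Properties using () renaming (_≟_ to _≟ᶠ_)
open import Data.Integer using (+0; +[1+_]; -[1+_]; +<+; +≤+; 0ℤ; _+_; _-_)
open import Data.Integer.Base using (nonNegative; positive; >-nonZero)
open import Data.Integer.Properties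
open import Data.Integer.Tactic.RingSolver using (solve-∀)
open import Algebra.Properties.AbelianGroup +-0-abelianGroup using (∙-cancelʳ)
open import Data.Product using (_,_; proj₁; proj₂)
open import Data.Sum using (_⊎_; inj₁; inj₂)
open import Data.Empty using (⊥-elim)
open import Relation.Nullary using (yes; no)
open import Relation.Binary.PropositionalEquality
  using (refl; sym; trans; cong; cong₂; subst; subst₂; _≢_)

height : Pt → Pt → Pt → ℤ
height a b x = det (b ⊖ a) (x ⊖ a)

offset : Pt → Pt → Pt → ℤ
offset a b x = dot (x ⊖ a) (b ⊖ a)

normSq : Pt → ℤ
normSq u = dot u u

*-nonNeg : ∀ {i j} → 0ℤ ≤ i → 0ℤ ≤ j → 0ℤ ≤ i * j
*-nonNeg {i} {j} 0≤i 0≤j =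
  subst (_≤ i * j) (*-zeroʳ i) (*-monoˡ-≤-nonNeg i {{nonNegative 0≤i}} 0≤j)

0≤i*k⇒0≤i : ∀ {i k} → 0ℤ < k → 0ℤ ≤ i * k → 0ℤ ≤ i
0≤i*k⇒0≤i {i} {k} 0<k 0≤ik =
  *-cancelʳ-≤-pos 0ℤ i k {{positive 0<k}} (subst (_≤ i * k) (sym (*-zeroˡ k)) 0≤ik)

k*i≡0⇒i≡0 : ∀ {k i} → 0ℤ < k → k * i ≡ 0ℤ → i ≡ 0ℤ
k*i≡0⇒i≡0 {k} {i} 0<k k*i≡0 =
  *-cancelˡ-≡ k i 0ℤ {{>-nonZero 0<k}} (trans k*i≡0 (sym (*-zeroʳ k)))

nonNeg-+≡0 : ∀ {i j} → 0ℤ ≤ i → 0ℤ ≤ j → i + j ≡ 0ℤ → i ≡ 0ℤ × j ≡ 0ℤ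
nonNeg-+≡0 {i} {j} 0≤i 0≤j i+j≡0 =
  i≡0 , trans (sym (+-identityˡ j)) (trans (cong (λ k → k + j) (sym i≡0)) i+j≡0)
  where
  i≡0 : i ≡ 0ℤ
  i≡0 = ≤-antisym (subst (i ≤_) i+j≡0 (i≤i+j i j {{nonNegative 0≤j}})) 0≤i

drop-vanishing : ∀ {u v e} c → e ≡ 0ℤ → u ≡ v + c * e → u ≡ v
drop-vanishing {v = v} c refl u≡v+c*0 =
  trans u≡v+c*0 (trans (cong (λ k → v + k) (*-zeroʳ c)) (+-identityʳ v))

0≤i+j⇒-i≤j : ∀ {i j} → 0ℤ ≤ i + j → - i ≤ j
0≤i+j⇒-i≤j {i} {j} 0≤i+j =
  0≤i-j⇒j≤i (subst (0ℤ ≤_) (trans (+-comm i j) (cong (λ k → j + k) (sym (neg-involutive i)))) 0≤i+j)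

square-nonNeg : ∀ i → 0ℤ ≤ i * i
square-nonNeg +0       = +≤+ z≤n
square-nonNeg +[1+ n ] = +≤+ z≤n
square-nonNeg -[1+ n ] = +≤+ z≤n

normSq-pos : ∀ {u} → u ≢ origin → 0ℤ < normSq u
normSq-pos {+0       , +0      } u≢0 = ⊥-elim (u≢0 refl)
normSq-pos {+0       , +[1+ n ]} _   = +<+ (s≤s z≤n)
normSq-pos {+0       , -[1+ n ]} _   = +<+ (s≤s z≤n)
normSq-pos {+[1+ m ] , u₂      } _   = +-mono-<-≤ (+<+ (s≤s z≤n)) (square-nonNeg u₂)
normSq-pos { -[1+ m ] , u₂     } _   = +-mono-<-≤ (+<+ (s≤s z≤n)) (square-nonNeg u₂)

det-pos⇒≢origin : ∀ {u z} → 0ℤ < det u z → u ≢ origin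
det-pos⇒≢origin 0<det refl = <-irrefl refl 0<det

⊖-self : ∀ a → a ⊖ a ≡ origin
⊖-self (a₁ , a₂) = cong₂ _,_ (+-inverseʳ a₁) (+-inverseʳ a₂)

det-self : ∀ u → det u u ≡ 0ℤ
det-self (u₁ , u₂) = trans (cong (λ k → u₁ * u₂ - k) (*-comm u₂ u₁)) (+-inverseʳ (u₁ * u₂))

det-originʳ : ∀ u → det u origin ≡ 0ℤ
det-originʳ (u₁ , u₂) rewrite *-zeroʳ u₁ | *-zeroʳ u₂ = refl

normSq-nonNeg : ∀ u → 0ℤ ≤ normSq u
normSq-nonNeg (u₁ , u₂) = +-mono-≤ (square-nonNeg u₁) (square-nonNeg u₂)

0<normSq⇒≢ : ∀ {a b} → 0ℤ < normSq (b ⊖ a) → a ≢ b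
0<normSq⇒≢ {a} 0<N refl = <-irrefl refl (subst (λ u → 0ℤ < normSq u) (⊖-self a) 0<N)

height-swap : ∀ a b x → height b a x ≡ - height a b x
height-swap (a₁ , a₂) (b₁ , b₂) (x₁ , x₂) = identity a₁ a₂ b₁ b₂ x₁ x₂
  where
  identity : ∀ a₁ a₂ b₁ b₂ x₁ x₂ →
    (a₁ - b₁) * (x₂ - b₂) - (a₂ - b₂) * (x₁ - b₁)
      ≡ - ((b₁ - a₁) * (x₂ - a₂) - (b₂ - a₂) * (x₁ - a₁))
  identity = solve-∀

offset-swap : ∀ a b x → offset b a x ≡ normSq (b ⊖ a) - offset a b x
offset-swap (a₁ , a₂) (b₁ , b₂) (x₁ , x₂) = identity a₁ a₂ b₁ b₂ x₁ x₂
  where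
  identity : ∀ a₁ a₂ b₁ b₂ x₁ x₂ →
    (x₁ - b₁) * (a₁ - b₁) + (x₂ - b₂) * (a₂ - b₂)
      ≡ ((b₁ - a₁) * (b₁ - a₁) + (b₂ - a₂) * (b₂ - a₂))
        - ((x₁ - a₁) * (b₁ - a₁) + (x₂ - a₂) * (b₂ - a₂))
  identity = solve-∀

normSq-swap : ∀ a b → normSq (a ⊖ b) ≡ normSq (b ⊖ a)
normSq-swap (a₁ , a₂) (b₁ , b₂) = identity a₁ a₂ b₁ b₂
  where
  identity : ∀ a₁ a₂ b₁ b₂ →
    (a₁ - b₁) * (a₁ - b₁) + (a₂ - b₂) * (a₂ - b₂) ≡ (b₁ - a₁) * (b₁ - a₁) + (b₂ - a₂) * (b₂ - a₂)
  identity = solve-∀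

OnSegment-start : ∀ a b → OnSegment a b a
OnSegment-start a b =
  trans (cong (det (b ⊖ a)) (⊖-self a)) (det-originʳ (b ⊖ a)) ,
  subst (λ u → 0ℤ ≤ dot u (b ⊖ a)) (sym (⊖-self a)) ≤-refl ,
  subst (λ u → dot u (b ⊖ a) ≤ normSq (b ⊖ a)) (sym (⊖-self a)) (normSq-nonNeg (b ⊖ a))

OnSegment-end : ∀ a b → OnSegment a b b
OnSegment-end a b = det-self (b ⊖ a) , normSq-nonNeg (b ⊖ a) , ≤-refl

OnSegment-sym : ∀ {a b x} → OnSegment a b x → OnSegment b a x
OnSegment-sym {a} {b} {x} (collinear , 0≤t , t≤N) =
  trans (height-swap a b x) (cong -_ collinear) ,
  subst (0ℤ ≤_) (sym (offset-swap a b x)) (i≤j⇒0≤j-i t≤N) ,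
  subst₂ _≤_ (sym (offset-swap a b x)) (sym (normSq-swap a b))
    (i-j≤i (normSq (b ⊖ a)) (offset a b x) {{nonNegative 0≤t}})

OnSegment-endpoint : ∀ {a b y} → y ≡ a ⊎ y ≡ b → OnSegment a b y
OnSegment-endpoint {a} {b} (inj₁ refl) = OnSegment-start a b
OnSegment-endpoint {a} {b} (inj₂ refl) = OnSegment-end a b

OnSegment-endpointsAmong : ∀ {A B a b x} → 0ℤ < normSq (b ⊖ a) →
  a ≡ A ⊎ a ≡ B → b ≡ A ⊎ b ≡ B → OnSegment a b x → OnSegment A B x
OnSegment-endpointsAmong _ (inj₁ refl) (inj₂ refl) x∈ab = x∈ab
OnSegment-endpointsAmong {A} {B} {x = x} _ (inj₂ refl) (inj₁ refl) x∈ab = OnSegment-sym {B} {A} {x} x∈ab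
OnSegment-endpointsAmong {A} 0<N (inj₁ refl) (inj₁ refl) _ = ⊥-elim (0<normSq⇒≢ {A} 0<N refl)
OnSegment-endpointsAmong {B = B} 0<N (inj₂ refl) (inj₂ refl) _ = ⊥-elim (0<normSq⇒≢ {B} 0<N refl)

segment-height-identity : ∀ a b x A B →
  normSq (b ⊖ a) * height A B x
    ≡ ((normSq (b ⊖ a) - offset a b x) * height A B a + offset a b x * height A B b)
      + dot (B ⊖ A) (b ⊖ a) * height a b x
segment-height-identity (a₁ , a₂) (b₁ , b₂) (x₁ , x₂) (A₁ , A₂) (B₁ , B₂) =
  identity a₁ a₂ b₁ b₂ x₁ x₂ A₁ A₂ B₁ B₂
  where
  identity : ∀ a₁ a₂ b₁ b₂ x₁ x₂ A₁ A₂ B₁ B₂ →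
    let N = (b₁ - a₁) * (b₁ - a₁) + (b₂ - a₂) * (b₂ - a₂)
        t = (x₁ - a₁) * (b₁ - a₁) + (x₂ - a₂) * (b₂ - a₂)
        h = λ y₁ y₂ → (B₁ - A₁) * (y₂ - A₂) - (B₂ - A₂) * (y₁ - A₁)
    in N * h x₁ x₂
         ≡ ((N - t) * h a₁ a₂ + t * h b₁ b₂)
           + ((B₁ - A₁) * (b₁ - a₁) + (B₂ - A₂) * (b₂ - a₂))
             * ((b₁ - a₁) * (x₂ - a₂) - (b₂ - a₂) * (x₁ - a₁))
  identity = solve-∀

segment-height : ∀ {a b x} A B → OnSegment a b x →
  normSq (b ⊖ a) * height A B x
    ≡ (normSq (b ⊖ a) - offset a b x) * height A B a + offset a b x * height A B b
segment-height {a} {b} {x} A B (collinear , _) =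
  drop-vanishing (dot (B ⊖ A) (b ⊖ a)) collinear (segment-height-identity a b x A B)

segment-height-nonNeg : ∀ {a b x} A B → 0ℤ < normSq (b ⊖ a) → OnSegment a b x →
  0ℤ ≤ height A B a → 0ℤ ≤ height A B b → 0ℤ ≤ height A B x
segment-height-nonNeg {a} {b} {x} A B 0<N x∈ab@(_ , 0≤t , t≤N) 0≤ha 0≤hb =
  0≤i*k⇒0≤i 0<N (subst (0ℤ ≤_)
    (trans (sym (segment-height {a} {b} {x} A B x∈ab)) (*-comm (normSq (b ⊖ a)) (height A B x)))
    (+-mono-≤ (*-nonNeg (i≤j⇒0≤j-i t≤N) 0≤ha) (*-nonNeg 0≤t 0≤hb)))

scaled-difference : ∀ {N t x a b} → 0ℤ < N → N * (x - a) ≡ t * (b - a) →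
  (t ≡ 0ℤ → x ≡ a) × (t ≡ N → x ≡ b)
scaled-difference {N} {t} {x} {a} {b} 0<N scaled = at-start , at-end
  where
  at-start : t ≡ 0ℤ → x ≡ a
  at-start refl = i-j≡0⇒i≡j x a (k*i≡0⇒i≡0 0<N scaled)
  at-end : t ≡ N → x ≡ b
  at-end refl = ∙-cancelʳ (- a) x b (*-cancelˡ-≡ N (x - a) (b - a) {{>-nonZero 0<N}} scaled)

collinear-scaling : ∀ a b x → height a b x ≡ 0ℤ →
  (normSq (b ⊖ a) * (proj₁ x - proj₁ a) ≡ offset a b x * (proj₁ b - proj₁ a)) ×
  (normSq (b ⊖ a) * (proj₂ x - proj₂ a) ≡ offset a b x * (proj₂ b - proj₂ a))
collinear-scaling (a₁ , a₂) (b₁ , b₂) (x₁ , x₂) collinear =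
  drop-vanishing (a₂ - b₂) collinear (identity₁ a₁ a₂ b₁ b₂ x₁ x₂) ,
  drop-vanishing (b₁ - a₁) collinear (identity₂ a₁ a₂ b₁ b₂ x₁ x₂)
  where
  identity₁ : ∀ a₁ a₂ b₁ b₂ x₁ x₂ →
    let N = (b₁ - a₁) * (b₁ - a₁) + (b₂ - a₂) * (b₂ - a₂)
        t = (x₁ - a₁) * (b₁ - a₁) + (x₂ - a₂) * (b₂ - a₂)
    in N * (x₁ - a₁) ≡ t * (b₁ - a₁) + (a₂ - b₂) * ((b₁ - a₁) * (x₂ - a₂) - (b₂ - a₂) * (x₁ - a₁))
  identity₁ = solve-∀
  identity₂ : ∀ a₁ a₂ b₁ b₂ x₁ x₂ →
    let N = (b₁ - a₁) * (b₁ - a₁) + (b₂ - a₂) * (b₂ - a₂)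
        t = (x₁ - a₁) * (b₁ - a₁) + (x₂ - a₂) * (b₂ - a₂)
    in N * (x₂ - a₂) ≡ t * (b₂ - a₂) + (b₁ - a₁) * ((b₁ - a₁) * (x₂ - a₂) - (b₂ - a₂) * (x₁ - a₁))
  identity₂ = solve-∀

collinear-endpoints : ∀ {a b x} → 0ℤ < normSq (b ⊖ a) → height a b x ≡ 0ℤ →
  (offset a b x ≡ 0ℤ → x ≡ a) × (offset a b x ≡ normSq (b ⊖ a) → x ≡ b)
collinear-endpoints {a} {b} {x} 0<N collinear =
  (λ t≡0 → cong₂ _,_ (proj₁ first t≡0) (proj₁ second t≡0)) ,
  (λ t≡N → cong₂ _,_ (proj₂ first t≡N) (proj₂ second t≡N))
  where
  first : (offset a b x ≡ 0ℤ → proj₁ x ≡ proj₁ a) × (offset a b x ≡ normSq (b ⊖ a) → proj₁ x ≡ proj₁ b)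
  first = scaled-difference 0<N (proj₁ (collinear-scaling a b x collinear))
  second : (offset a b x ≡ 0ℤ → proj₂ x ≡ proj₂ a) × (offset a b x ≡ normSq (b ⊖ a) → proj₂ x ≡ proj₂ b)
  second = scaled-difference 0<N (proj₂ (collinear-scaling a b x collinear))

segment-height-zero : ∀ {a b x} A B → 0ℤ < normSq (b ⊖ a) → OnSegment a b x →
  0ℤ ≤ height A B a → 0ℤ ≤ height A B b → height A B x ≡ 0ℤ →
  (x ≡ a × height A B a ≡ 0ℤ) ⊎ (x ≡ b × height A B b ≡ 0ℤ) ⊎
  (height A B a ≡ 0ℤ × height A B b ≡ 0ℤ)
segment-height-zero {a} {b} {x} A B 0<N x∈ab@(collinear , 0≤t , t≤N) 0≤ha 0≤hb hx≡0 =
  cases (i*j≡0⇒i≡0∨j≡0 (N - t) (proj₁ terms≡0)) (i*j≡0⇒i≡0∨j≡0 t (proj₂ terms≡0))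
  where
  N = normSq (b ⊖ a)
  t = offset a b x
  terms≡0 : (N - t) * height A B a ≡ 0ℤ × t * height A B b ≡ 0ℤ
  terms≡0 = nonNeg-+≡0 (*-nonNeg (i≤j⇒0≤j-i t≤N) 0≤ha) (*-nonNeg 0≤t 0≤hb)
    (trans (sym (segment-height {a} {b} {x} A B x∈ab)) (trans (cong (N *_) hx≡0) (*-zeroʳ N)))
  endpoints : (t ≡ 0ℤ → x ≡ a) × (t ≡ N → x ≡ b)
  endpoints = collinear-endpoints {a} {b} {x} 0<N collinear
  cases : N - t ≡ 0ℤ ⊎ height A B a ≡ 0ℤ → t ≡ 0ℤ ⊎ height A B b ≡ 0ℤ →
    (x ≡ a × height A B a ≡ 0ℤ) ⊎ (x ≡ b × height A B b ≡ 0ℤ) ⊎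
    (height A B a ≡ 0ℤ × height A B b ≡ 0ℤ)
  cases (inj₁ N-t≡0) _ =
    inj₂ (inj₁ (proj₂ endpoints t≡N ,
                k*i≡0⇒i≡0 0<N (subst (λ s → s * height A B b ≡ 0ℤ) t≡N (proj₂ terms≡0))))
    where
    t≡N : t ≡ N
    t≡N = sym (i-j≡0⇒i≡j N t N-t≡0)
  cases (inj₂ ha≡0) (inj₁ t≡0)  = inj₁ (proj₁ endpoints t≡0 , ha≡0)
  cases (inj₂ ha≡0) (inj₂ hb≡0) = inj₂ (inj₂ (ha≡0 , hb≡0))

module _ (P : Polygon) (fano : IsFano P) where
  open IsFano fano

  edge-normSq-pos : ∀ j → 0ℤ < normSq (w P (nxt j) ⊖ w P j)
  edge-normSq-pos j =
    normSq-pos {w P (nxt j) ⊖ w P j} (det-pos⇒≢origin {z = origin ⊖ w P j} (originInterior j))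

  vertex-endpoint-or-above : ∀ j l →
    (w P l ≡ w P j ⊎ w P l ≡ w P (nxt j)) ⊎ 0ℤ < height (w P j) (w P (nxt j)) (w P l)
  vertex-endpoint-or-above j l with l ≟ᶠ j | l ≟ᶠ nxt j
  ... | yes refl | _        = inj₁ (inj₁ refl)
  ... | no _     | yes refl = inj₁ (inj₂ refl)
  ... | no l≢j   | no l≢j+1 = inj₂ (convex P j l l≢j l≢j+1)

  vertex-height-nonNeg : ∀ j l → 0ℤ ≤ height (w P j) (w P (nxt j)) (w P l)
  vertex-height-nonNeg j l with vertex-endpoint-or-above j l
  ... | inj₁ endpoint = ≤-reflexive (sym (proj₁ (OnSegment-endpoint {w P j} {w P (nxt j)} endpoint)))
  ... | inj₂ above    = <⇒≤ above

  vertex-height-zero : ∀ j l → height (w P j) (w P (nxt j)) (w P l) ≡ 0ℤ →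
    w P l ≡ w P j ⊎ w P l ≡ w P (nxt j)
  vertex-height-zero j l h≡0 with vertex-endpoint-or-above j l
  ... | inj₁ endpoint = endpoint
  ... | inj₂ above    = ⊥-elim (<-irrefl (sym h≡0) above)

  boundary-height-nonNeg : ∀ j {x} → OnBoundary P x → 0ℤ ≤ height (w P j) (w P (nxt j)) x
  boundary-height-nonNeg j {x} (k , x∈k) =
    segment-height-nonNeg {w P k} {w P (nxt k)} {x} (w P j) (w P (nxt j))
      (edge-normSq-pos k) x∈k (vertex-height-nonNeg j k) (vertex-height-nonNeg j (nxt k))

  boundary-height-zero⇒OnEdge : ∀ j {x} → OnBoundary P x →
    height (w P j) (w P (nxt j)) x ≡ 0ℤ → OnEdge P j x
  boundary-height-zero⇒OnEdge j {x} (k , x∈k) hx≡0 =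
    cases (segment-height-zero {a} {b} {x} A B (edge-normSq-pos k) x∈k
             (vertex-height-nonNeg j k) (vertex-height-nonNeg j (nxt k)) hx≡0)
    where
    A = w P j
    B = w P (nxt j)
    a = w P k
    b = w P (nxt k)
    cases : (x ≡ a × height A B a ≡ 0ℤ) ⊎ (x ≡ b × height A B b ≡ 0ℤ) ⊎
            (height A B a ≡ 0ℤ × height A B b ≡ 0ℤ) → OnSegment A B x
    cases (inj₁ (x≡a , ha≡0)) =
      subst (OnSegment A B) (sym x≡a) (OnSegment-endpoint {A} {B} {a} (vertex-height-zero j k ha≡0))
    cases (inj₂ (inj₁ (x≡b , hb≡0))) =
      subst (OnSegment A B) (sym x≡b) (OnSegment-endpoint {A} {B} {b} (vertex-height-zero j (nxt k) hb≡0))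
    cases (inj₂ (inj₂ (ha≡0 , hb≡0))) =
      OnSegment-endpointsAmong {A} {B} {a} {b} {x} (edge-normSq-pos k)
        (vertex-height-zero j k ha≡0) (vertex-height-zero j (nxt k) hb≡0) x∈k

-- height A B is affine with constant term height A B origin; its linear part kills
-- the relation, and the coefficients q, q, p add up to 2q + p.
balanced-height : ∀ A B x y z p q → (q · (x ⊕ z)) ⊕ (p · y) ≡ origin → height A B y ≡ 0ℤ →
  q * (height A B x + height A B z) ≡ (+ 2 * q + p) * height A B origin
balanced-height (A₁ , A₂) (B₁ , B₂) (x₁ , x₂) (y₁ , y₂) (z₁ , z₂) p q relation hy≡0 =
  drop-vanishing (- p) hy≡0 (
  drop-vanishing (B₁ - A₁) second≡0 (
  drop-vanishing (- (B₂ - A₂)) first≡0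
    (identity A₁ A₂ B₁ B₂ x₁ x₂ y₁ y₂ z₁ z₂ p q)))
  where
  identity : ∀ A₁ A₂ B₁ B₂ x₁ x₂ y₁ y₂ z₁ z₂ p q →
    let h = λ u₁ u₂ → (B₁ - A₁) * (u₂ - A₂) - (B₂ - A₂) * (u₁ - A₁)
    in q * (h x₁ x₂ + h z₁ z₂)
         ≡ (((+ 2 * q + p) * h (+ 0) (+ 0) + (- p) * h y₁ y₂)
            + (B₁ - A₁) * (q * (x₂ + z₂) + p * y₂))
           + (- (B₂ - A₂)) * (q * (x₁ + z₁) + p * y₁)
  identity = solve-∀
  first≡0 : q * (x₁ + z₁) + p * y₁ ≡ 0ℤ
  first≡0 = cong proj₁ relation
  second≡0 : q * (x₂ + z₂) + p * y₂ ≡ 0ℤ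
  second≡0 = cong proj₂ relation

lemma3p1 : (P : Polygon) → IsFano P →
    (n : ℕ) (v : Fin (suc n) → Pt) (r : ℤ) →
    (∀ i → OnBoundary P (v i)) →
    Anticlockwise v →
    (∀ j → ∃ λ i → v i ≡ w P j) →
    (∀ i → det (v i) (v (nxt i)) ≡ r) →
    ∀ i (p q : ℤ) → + 0 < q →
    (q · (v (prv i) ⊕ v (nxt i))) ⊕ (p · v i) ≡ origin →
    ((- (+ 2 * q)) ≤ p)
    × (p ≡ - (+ 2 * q) →
    ∃ λ j → OnEdge P j (v (prv i)) × OnEdge P j (v i) × OnEdge P j (v (nxt i)))
lemma3p1 P fano _ v _ onBoundary _ _ _ i p q 0<q relation = 0≤i+j⇒-i≤j 0≤2q+p , common-edge
  where
  j = proj₁ (onBoundary i)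
  A = w P j
  B = w P (nxt j)
  x = v (prv i)
  z = v (nxt i)
  0≤hx : 0ℤ ≤ height A B x
  0≤hx = boundary-height-nonNeg P fano j {x} (onBoundary (prv i))
  0≤hz : 0ℤ ≤ height A B z
  0≤hz = boundary-height-nonNeg P fano j {z} (onBoundary (nxt i))
  balanced : q * (height A B x + height A B z) ≡ (+ 2 * q + p) * height A B origin
  balanced = balanced-height A B x (v i) z p q relation (proj₁ (proj₂ (onBoundary i)))
  0≤2q+p : 0ℤ ≤ + 2 * q + p
  0≤2q+p = 0≤i*k⇒0≤i (IsFano.originInterior fano j)
    (subst (0ℤ ≤_) balanced (*-nonNeg (<⇒≤ 0<q) (+-mono-≤ 0≤hx 0≤hz)))
  common-edge : p ≡ - (+ 2 * q) →
    ∃ λ j → OnEdge P j (v (prv i)) × OnEdge P j (v i) × OnEdge P j (v (nxt i))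
  common-edge refl =
    j , boundary-height-zero⇒OnEdge P fano j {x} (onBoundary (prv i)) (proj₁ heights≡0) ,
        proj₂ (onBoundary i) ,
        boundary-height-zero⇒OnEdge P fano j {z} (onBoundary (nxt i)) (proj₂ heights≡0)
    where
    heights≡0 : height A B x ≡ 0ℤ × height A B z ≡ 0ℤ
    heights≡0 = nonNeg-+≡0 0≤hx 0≤hz
      (k*i≡0⇒i≡0 0<q (trans balanced (cong (_* height A B origin) (+-inverseʳ (+ 2 * q)))))
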